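{- Let $T\ge5$ be a square-free integer, let $E$ be the elliptic curve $y^2=x^3-T^2x$ over $\mathbb{Q}$, let $P\in E(\mathbb{Q})$ be a non-torsion point, and for $m\ge1$ write $x(mP)=A_m/B_m$ in lowest terms with $A_m\in\mathbb{Z}$, $B_m\in\mathbb{N}$. Then $$3\log\max\{|A_m|,B_m\}-\log T-0.693\le \log|A_m|+\log B_m+\log|A_m^2-T^2B_m^2|.$$ -}

module Defs where

open import Data.Nat as ℕ using (ℕ; zero; suc; _⊔_)
open import Data.Nat.Divisibility using (_∣_)
open import Data.Integer as ℤ using (ℤ; ∣_∣)
open import Data.Rational as ℚ using (ℚ; 0ℚ; 1ℚ; _≤_; _<_; ↥_; ↧ₙ_; ≢-nonZero)
open import Data.Rational.Properties using (_≟_)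
open import Data.Unit using (⊤)
open import Data.Product using (Σ; _×_; ∃-syntax)
open import Relation.Nullary using (¬_; yes; no)
open import Relation.Binary.PropositionalEquality using (_≡_; _≢_)

SquareFree : ℕ → Set
SquareFree n = ∀ d → (d ℕ.* d) ∣ n → d ≡ 1

ℕ→ℚ : ℕ → ℚ
ℕ→ℚ n = ℤ.+ n ℚ./ 1

data Pt : Set where
  O   : Pt            -- point at infinity (identity)
  aff : ℚ → ℚ → Pt

OnCurve : ℕ → Pt → Set
OnCurve T O         = ⊤
OnCurve T (aff x y) = y ℚ.* y ≡ x ℚ.* x ℚ.* x ℚ.- ℕ→ℚ (T ℕ.* T) ℚ.* x

-- chord-and-tangent addition on y² = x³ + a x + b with a = −T²
add : ℕ → Pt → Pt → Pt
add T O q = q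
add T p O = p
add T (aff x₁ y₁) (aff x₂ y₂) with x₂ ℚ.- x₁ ≟ 0ℚ
... | no d≢0 =
  let instance _ = ≢-nonZero d≢0
      λ' = (y₂ ℚ.- y₁) ℚ.÷ (x₂ ℚ.- x₁)
      x₃ = λ' ℚ.* λ' ℚ.- x₁ ℚ.- x₂
  in aff x₃ (λ' ℚ.* (x₁ ℚ.- x₃) ℚ.- y₁)
... | yes _ with y₁ ℚ.+ y₂ ≟ 0ℚ
...   | yes _ = O
...   | no s≢0 =
  -- here x₁ = x₂ and y₁ = y₂ ≠ 0 (on the curve): tangent doubling
  let instance _ = ≢-nonZero s≢0
      λ' = (ℕ→ℚ 3 ℚ.* x₁ ℚ.* x₁ ℚ.- ℕ→ℚ (T ℕ.* T)) ℚ.÷ (y₁ ℚ.+ y₂)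
      x₃ = λ' ℚ.* λ' ℚ.- x₁ ℚ.- x₂
  in aff x₃ (λ' ℚ.* (x₁ ℚ.- x₃) ℚ.- y₁)

mul : ℕ → ℕ → Pt → Pt
mul T zero    p = O
mul T (suc m) p = add T p (mul T m p)

NonTorsion : ℕ → Pt → Set
NonTorsion T p = ∀ m → 1 ℕ.≤ m → mul T m p ≢ O

-- k-th partial sum  Σ_{i<k} x^i / i!
expPartial : ℚ → ℕ → ℚ
expPartial x k = go k 1ℚ 0
  where
  -- term = x^i / i!, i = current index
  go : ℕ → ℚ → ℕ → ℚ
  go zero    term i = 0ℚ
  go (suc k) term i =
    term ℚ.+ go k (term ℚ.* x ℚ.* (ℤ.+ 1 ℚ./ suc i)) (suc i)

-- N ≤ e^x · M   (N, M ≥ 0), i.e. N ≤ sup_k S_k(x) · M, written as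
-- ∀ ε > 0, ∃ k, N ≤ (S_k(x) + ε) · M
_≤exp[_]·_ : ℕ → ℚ → ℕ → Set
N ≤exp[ x ]· M =
  ∀ (ε : ℚ) → 0ℚ < ε → ∃[ k ] (ℕ→ℚ N ≤ (expPartial x k ℚ.+ ε) ℚ.* ℕ→ℚ M)

-- x(mP) = A/B in lowest terms: A = ↥ x (numerator), B = ↧ₙ x (denominator)

lhsN : ℚ → ℕ
lhsN x = let H = ∣ ↥ x ∣ ⊔ ↧ₙ x in H ℕ.* H ℕ.* H

rhsM : ℕ → ℚ → ℕ
rhsM T x =
  let A = ↥ x
      B = ℤ.+ (↧ₙ x)
      T' = ℤ.+ T
  in T ℕ.* ∣ A ∣ ℕ.* ↧ₙ x ℕ.* ∣ A ℤ.* A ℤ.- T' ℤ.* T' ℤ.* B ℤ.* B ∣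

c0693 : ℚ
c0693 = ℤ.+ 693 ℚ./ 1000

-- Write x(mP) = A / B.  If A = 0 or A² = T² B², then x(mP) is a root of
-- x³ - T² x, so y(mP) = 0 and mP is its own negative.  Then (m + m)P = O,
-- contradicting that P has infinite order; no associativity of the group law
-- is needed for this: with f = P + _ and g = -P + _, on the nonsingular curve
-- g undoes f and negation turns f into g, so
-- -((m + m)P) = -(fᵐ(mP)) = gᵐ(-(mP)) = gᵐ(fᵐ(O)) = O.
-- Otherwise D = |A² - T² B²| ≥ 1, and comparing |A| with T B gives
-- max(|A|, B)³ ≤ T |A| B D, which is the claim even without the factor
-- e^0.693 and without T being square-free.
module Submission where

open import Defs
open import Data.Nat using (ℕ; _≤_)
open import Data.Rational using (ℚ)
open import Relation.Binary.PropositionalEquality using (_≡_)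

open import Data.Maybe.Base using (Maybe; just; nothing)
open import Data.Nat.GeneralisedArithmetic using (fold; fold-+)
open import Data.Product using (_×_; _,_; ∃-syntax)
open import Data.Sum using (_⊎_; inj₁; inj₂)
open import Data.Unit using (tt)
open import Function using (_∘_)
open import Level using (0ℓ)
open import Relation.Binary.PropositionalEquality
  using (refl; sym; trans; cong; cong₂; subst; subst₂; _≢_; module ≡-Reasoning)
open import Relation.Nullary using (yes; no; contradiction)
import Data.Integer as ℤ
import Data.Integer.Properties as ℤ
import Data.Integer.Tactic.RingSolver as ℤ-Solver
import Data.Nat as ℕ
import Data.Nat.Coprimality as Coprimality
import Data.Nat.Properties as ℕ
import Data.Nat.Tactic.RingSolver as ℕ-Solver
import Data.Rational as ℚ
import Data.Rational.Properties as ℚ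
import Data.Rational.Unnormalised as ℚᵘ
import Data.Rational.Unnormalised.Properties as ℚᵘ
open import Tactic.RingSolver using (solve-∀)
import Tactic.RingSolver.Core.AlmostCommutativeRing as ACR

module _ {a p} {A : Set a} {C : A → Set p} {f : A → A}
         (f-preserves : ∀ {s} → C s → C (f s)) where
  open ≡-Reasoning

  fold-preserves : ∀ n {s} → C s → C (fold s f n)
  fold-preserves ℕ.zero    Cs = Cs
  fold-preserves (ℕ.suc n) Cs = f-preserves (fold-preserves n Cs)

  fold-inverse : ∀ {g : A → A} → (∀ {s} → C s → g (f s) ≡ s) →
                 ∀ n {s} → C s → fold (fold s f n) g n ≡ s
  fold-inverse         g∘f≡id ℕ.zero    Cs = refl
  fold-inverse {g = g} g∘f≡id (ℕ.suc n) {s} Cs = begin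
    g (fold (fold s f (ℕ.suc n)) g n) ≡⟨ cong (λ r → g (fold r g n)) fold-suc ⟩
    g (fold (fold (f s) f n) g n)     ≡⟨ cong g (fold-inverse g∘f≡id n (f-preserves Cs)) ⟩
    g (f s)                           ≡⟨ g∘f≡id Cs ⟩
    s                                 ∎
    where
    fold-suc : fold s f (ℕ.suc n) ≡ fold (f s) f n
    fold-suc = trans (cong (fold s f) (ℕ.+-comm 1 n)) (fold-+ s f n)

  fold-commute : ∀ {g h : A → A} → (∀ {s} → C s → h (f s) ≡ g (h s)) →
                 ∀ n {s} → C s → h (fold s f n) ≡ fold (h s) g n
  fold-commute         h∘f≡g∘h ℕ.zero    Cs = refl
  fold-commute {g = g} h∘f≡g∘h (ℕ.suc n) Cs =
    trans (h∘f≡g∘h (fold-preserves n Cs)) (cong g (fold-commute h∘f≡g∘h n Cs))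

module RationalField where
  open import Data.Rational
    using (0ℚ; 1ℚ; _+_; _*_; _-_; _÷_; 1/_; NonZero)
  open import Algebra.Properties.Group ℚ.+-0-group public
    using () renaming ( x∙y⁻¹≈ε⇒x≈y to p-q≡0⇒p≡q; x≈y⇒x∙y⁻¹≈ε to p≡q⇒p-q≡0
                      ; inverseʳ-unique to p+q≡0⇒q≡-p)
  open import Algebra.Apartness.Properties.HeytingCommutativeRing ℚ.heytingCommutativeRing
    using (x#0y#0→xy#0)
  open ≡-Reasoning

  ℚ-ring : ACR.AlmostCommutativeRing 0ℓ 0ℓ
  ℚ-ring = ACR.fromCommutativeRing ℚ.+-*-commutativeRing isZero
    where
    isZero : ∀ p → Maybe (0ℚ ≡ p)
    isZero p with p ℚ.≟ 0ℚ
    ... | yes p≡0 = just (sym p≡0)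
    ... | no  _   = nothing

  p*q≡0⇒q≡0 : ∀ {p q} → p ≢ 0ℚ → p * q ≡ 0ℚ → q ≡ 0ℚ
  p*q≡0⇒q≡0 {p} {q} p≢0 pq≡0 with q ℚ.≟ 0ℚ
  ... | yes q≡0 = q≡0
  ... | no  q≢0 = contradiction pq≡0 (x#0y#0→xy#0 p≢0 q≢0)

  p*p≡0⇒p≡0 : ∀ {p} → p * p ≡ 0ℚ → p ≡ 0ℚ
  p*p≡0⇒p≡0 {p} pp≡0 with p ℚ.≟ 0ℚ
  ... | yes p≡0 = p≡0
  ... | no  p≢0 = p*q≡0⇒q≡0 p≢0 pp≡0

  p+p≡0⇒p≡0 : ∀ {p} → p + p ≡ 0ℚ → p ≡ 0ℚ
  p+p≡0⇒p≡0 {p} p+p≡0 = p*q≡0⇒q≡0 {1ℚ + 1ℚ} (λ ()) (trans (double p) p+p≡0)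
    where
    double : ∀ p → (1ℚ + 1ℚ) * p ≡ p + p
    double = solve-∀ ℚ-ring

  *-cancelʳ-≡ : ∀ {p q r} → r ≢ 0ℚ → p * r ≡ q * r → p ≡ q
  *-cancelʳ-≡ {p} {q} {r} r≢0 pr≡qr = p-q≡0⇒p≡q p q (p*q≡0⇒q≡0 r≢0 (begin
    r * (p - q)   ≡⟨ distrib p q r ⟩
    p * r - q * r ≡⟨ p≡q⇒p-q≡0 pr≡qr ⟩
    0ℚ            ∎))
    where
    distrib : ∀ p q r → r * (p - q) ≡ p * r - q * r
    distrib = solve-∀ ℚ-ring

  ÷-*-cancel : ∀ p q .{{_ : NonZero q}} → (p ÷ q) * q ≡ p
  ÷-*-cancel p q = begin
    (p * 1/ q) * q ≡⟨ ℚ.*-assoc p (1/ q) q ⟩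
    p * (1/ q * q) ≡⟨ cong (p *_) (ℚ.*-inverseˡ q) ⟩
    p * 1ℚ         ≡⟨ ℚ.*-identityʳ p ⟩
    p              ∎

neg : Pt → Pt
neg O         = O
neg (aff x y) = aff x (ℚ.- y)

neg≡O⇒≡O : ∀ {P} → neg P ≡ O → P ≡ O
neg≡O⇒≡O {O} _ = refl

mul≡fold : ∀ T m {P} → mul T m P ≡ fold O (add T P) m
mul≡fold T ℕ.zero         = refl
mul≡fold T (ℕ.suc m) {P} = cong (add T P) (mul≡fold T m)

module Curve (T : ℕ) where
  open import Data.Rational
    using (0ℚ; 1ℚ; _+_; _*_; _-_; -_; _÷_; ≢-nonZero)
  open RationalField
  open ≡-Reasoning

  T² : ℚ
  T² = ℕ→ℚ (T ℕ.* T)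

  cubic : ℚ → ℚ
  cubic x = x * x * x - T² * x

  cubic-0 : cubic 0ℚ ≡ 0ℚ
  cubic-0 = cong (λ z → 0ℚ - z) (ℚ.*-zeroʳ T²)

  x*x≡T²⇒cubic≡0 : ∀ {x} → x * x ≡ T² → cubic x ≡ 0ℚ
  x*x≡T²⇒cubic≡0 {x} x*x≡T² = begin
    cubic x             ≡⟨ factor x T² ⟩
    x * (x * x - T²)    ≡⟨ cong (λ s → x * (s - T²)) x*x≡T² ⟩
    x * (T² - T²)       ≡⟨ cong (x *_) (ℚ.+-inverseʳ T²) ⟩
    x * 0ℚ              ≡⟨ ℚ.*-zeroʳ x ⟩
    0ℚ                  ∎
    where
    factor : ∀ x c → x * x * x - c * x ≡ x * (x * x - c)
    factor = solve-∀ ℚ-ring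

  -- For (x₁, y₁) on the curve, the line through it of slope l meets the curve
  -- again exactly at the roots of this quadratic in x; they sum to l² - x₁.
  residual : ℚ → ℚ → ℚ → ℚ → ℚ
  residual l x₁ y₁ x = x * x + x₁ * x + x₁ * x₁ - T² - l * l * (x - x₁) - l * (y₁ + y₁)

  -- For x₂ = x₁ this says the line is tangent at (x₁, y₁).
  record Secant (l x₁ y₁ x₂ y₂ : ℚ) : Set where
    constructor secant
    field
      passes : y₂ ≡ y₁ + l * (x₂ - x₁)
      meets  : residual l x₁ y₁ x₂ ≡ 0ℚ

  secantX : ℚ → ℚ → ℚ → ℚ
  secantX l x₁ x₂ = l * l - x₁ - x₂

  secantY : ℚ → ℚ → ℚ → ℚ → ℚ
  secantY l x₁ y₁ x₂ = l * (x₁ - secantX l x₁ x₂) - y₁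

  secantSum : ℚ → ℚ → ℚ → ℚ → Pt
  secantSum l x₁ y₁ x₂ = aff (secantX l x₁ x₂) (secantY l x₁ y₁ x₂)

  line-meets-curve : ∀ {x₁ y₁} → OnCurve T (aff x₁ y₁) → ∀ l x →
    cubic x - (y₁ + l * (x - x₁)) * (y₁ + l * (x - x₁)) ≡ (x - x₁) * residual l x₁ y₁ x
  line-meets-curve {x₁} {y₁} on₁ l x = begin
    cubic x - (y₁ + l * (x - x₁)) * (y₁ + l * (x - x₁))    ≡⟨ identity l x₁ y₁ x T² ⟩
    (x - x₁) * residual l x₁ y₁ x + (cubic x₁ - y₁ * y₁)   ≡⟨ cong ((x - x₁) * residual l x₁ y₁ x +_) (p≡q⇒p-q≡0 (sym on₁)) ⟩
    (x - x₁) * residual l x₁ y₁ x + 0ℚ                     ≡⟨ ℚ.+-identityʳ _ ⟩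
    (x - x₁) * residual l x₁ y₁ x                          ∎
    where
    identity : ∀ l x₁ y₁ x c →
      x * x * x - c * x - (y₁ + l * (x - x₁)) * (y₁ + l * (x - x₁)) ≡
      (x - x₁) * (x * x + x₁ * x + x₁ * x₁ - c - l * l * (x - x₁) - l * (y₁ + y₁))
        + (x₁ * x₁ * x₁ - c * x₁ - y₁ * y₁)
    identity = solve-∀ ℚ-ring

  residual-swap : ∀ l x₁ y₁ x → residual l x₁ y₁ (secantX l x₁ x) ≡ residual l x₁ y₁ x
  residual-swap l x₁ y₁ x = identity l x₁ y₁ x T²
    where
    identity : ∀ l x₁ y₁ x c →
      let x' = l * l - x₁ - x in
      x' * x' + x₁ * x' + x₁ * x₁ - c - l * l * (x' - x₁) - l * (y₁ + y₁) ≡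
      x * x + x₁ * x + x₁ * x₁ - c - l * l * (x - x₁) - l * (y₁ + y₁)
    identity = solve-∀ ℚ-ring

  residual-neg : ∀ l x₁ y₁ x → residual (- l) x₁ (- y₁) x ≡ residual l x₁ y₁ x
  residual-neg l x₁ y₁ x = identity l x₁ y₁ x T²
    where
    identity : ∀ l x₁ y₁ x c →
      x * x + x₁ * x + x₁ * x₁ - c - (- l) * (- l) * (x - x₁) - (- l) * ((- y₁) + (- y₁)) ≡
      x * x + x₁ * x + x₁ * x₁ - c - l * l * (x - x₁) - l * (y₁ + y₁)
    identity = solve-∀ ℚ-ring

  residual-tangent : ∀ l x₁ y₁ →
    residual l x₁ y₁ x₁ ≡ ℕ→ℚ 3 * x₁ * x₁ - T² - l * (y₁ + y₁)
  residual-tangent l x₁ y₁ = identity l x₁ y₁ T²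
    where
    identity : ∀ l x₁ y₁ c →
      x₁ * x₁ + x₁ * x₁ + x₁ * x₁ - c - l * l * (x₁ - x₁) - l * (y₁ + y₁) ≡
      ℕ→ℚ 3 * x₁ * x₁ - c - l * (y₁ + y₁)
    identity = solve-∀ ℚ-ring

  secantSum-onCurve : ∀ {l x₁ y₁ x₂} → OnCurve T (aff x₁ y₁) → residual l x₁ y₁ x₂ ≡ 0ℚ →
                      OnCurve T (secantSum l x₁ y₁ x₂)
  secantSum-onCurve {l} {x₁} {y₁} {x₂} on₁ meets = begin
    secantY l x₁ y₁ x₂ * secantY l x₁ y₁ x₂ ≡⟨ reflect l x₁ y₁ X ⟩
    L * L                                   ≡⟨ p-q≡0⇒p≡q (cubic X) (L * L) cubic-L²≡0 ⟨
    cubic X                                 ∎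
    where
    X = secantX l x₁ x₂
    L = y₁ + l * (X - x₁)
    reflect : ∀ l x₁ y₁ X → (l * (x₁ - X) - y₁) * (l * (x₁ - X) - y₁) ≡
                            (y₁ + l * (X - x₁)) * (y₁ + l * (X - x₁))
    reflect = solve-∀ ℚ-ring
    cubic-L²≡0 : cubic X - L * L ≡ 0ℚ
    cubic-L²≡0 = begin
      cubic X - L * L               ≡⟨ line-meets-curve {x₁} {y₁} on₁ l X ⟩
      (X - x₁) * residual l x₁ y₁ X ≡⟨ cong ((X - x₁) *_) (trans (residual-swap l x₁ y₁ x₂) meets) ⟩
      (X - x₁) * 0ℚ                 ≡⟨ ℚ.*-zeroʳ (X - x₁) ⟩
      0ℚ                            ∎

  chord-residual≡0 : ∀ {l x₁ y₁ x₂ y₂} → x₂ - x₁ ≢ 0ℚ →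
                     OnCurve T (aff x₁ y₁) → OnCurve T (aff x₂ y₂) →
                     y₂ ≡ y₁ + l * (x₂ - x₁) → residual l x₁ y₁ x₂ ≡ 0ℚ
  chord-residual≡0 {l} {x₁} {y₁} {x₂} {y₂} dx≢0 on₁ on₂ passes = p*q≡0⇒q≡0 dx≢0 (begin
    (x₂ - x₁) * residual l x₁ y₁ x₂                       ≡⟨ line-meets-curve {x₁} {y₁} on₁ l x₂ ⟨
    cubic x₂ - (y₁ + l * (x₂ - x₁)) * (y₁ + l * (x₂ - x₁)) ≡⟨ cong (λ y → cubic x₂ - y * y) passes ⟨
    cubic x₂ - y₂ * y₂                                    ≡⟨ p≡q⇒p-q≡0 (sym on₂) ⟩
    0ℚ                                                    ∎)

  tangent-secant : ∀ {x₁ y₁} → y₁ + y₁ ≢ 0ℚ → ∃[ l ] Secant l x₁ y₁ x₁ y₁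
  tangent-secant {x₁} {y₁} 2y₁≢0 = l , secant passes meets
    where
    instance _ = ≢-nonZero 2y₁≢0
    l = (ℕ→ℚ 3 * x₁ * x₁ - T²) ÷ (y₁ + y₁)
    passes : y₁ ≡ y₁ + l * (x₁ - x₁)
    passes = identity y₁ l x₁
      where
      identity : ∀ y l x → y ≡ y + l * (x - x)
      identity = solve-∀ ℚ-ring
    meets : residual l x₁ y₁ x₁ ≡ 0ℚ
    meets = trans (residual-tangent l x₁ y₁) (p≡q⇒p-q≡0 (sym (÷-*-cancel (ℕ→ℚ 3 * x₁ * x₁ - T²) (y₁ + y₁))))

  secant⇒tangent : ∀ {l x₁ y₁ y₂} → Secant l x₁ y₁ x₁ y₂ →
                   y₂ ≡ y₁ × l * (y₁ + y₂) ≡ ℕ→ℚ 3 * x₁ * x₁ - T²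
  secant⇒tangent {l} {x₁} {y₁} (secant passes meets) with trans passes (identity y₁ l x₁)
    where
    identity : ∀ y l x → y + l * (x - x) ≡ y
    identity = solve-∀ ℚ-ring
  ... | refl = refl , sym (p-q≡0⇒p≡q _ _ (trans (sym (residual-tangent l x₁ y₁)) meets))

  same-x⇒same-y : ∀ {x y₁ y₂} → OnCurve T (aff x y₁) → OnCurve T (aff x y₂) →
                  y₁ + y₂ ≢ 0ℚ → y₂ ≡ y₁
  same-x⇒same-y {x} {y₁} {y₂} on₁ on₂ sum≢0 = p-q≡0⇒p≡q y₂ y₁ (p*q≡0⇒q≡0 sum≢0 (begin
    (y₁ + y₂) * (y₂ - y₁) ≡⟨ identity y₁ y₂ ⟩
    y₂ * y₂ - y₁ * y₁     ≡⟨ cong₂ _-_ on₂ on₁ ⟩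
    cubic x - cubic x     ≡⟨ ℚ.+-inverseʳ (cubic x) ⟩
    0ℚ                    ∎))
    where
    identity : ∀ y₁ y₂ → (y₁ + y₂) * (y₂ - y₁) ≡ y₂ * y₂ - y₁ * y₁
    identity = solve-∀ ℚ-ring

  secant-or-opposite : ∀ {x₁ y₁ x₂ y₂} → OnCurve T (aff x₁ y₁) → OnCurve T (aff x₂ y₂) →
                       (x₂ ≡ x₁ × y₂ ≡ - y₁) ⊎ ∃[ l ] Secant l x₁ y₁ x₂ y₂
  secant-or-opposite {x₁} {y₁} {x₂} {y₂} on₁ on₂ with x₂ ℚ.≟ x₁
  ... | no x₂≢x₁ = inj₂ (l , secant passes (chord-residual≡0 {l} {x₁} {y₁} {x₂} {y₂} dx≢0 on₁ on₂ passes))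
    where
    dx≢0 : x₂ - x₁ ≢ 0ℚ
    dx≢0 = x₂≢x₁ ∘ p-q≡0⇒p≡q x₂ x₁
    instance _ = ≢-nonZero dx≢0
    l = (y₂ - y₁) ÷ (x₂ - x₁)
    passes : y₂ ≡ y₁ + l * (x₂ - x₁)
    passes = trans (identity y₁ y₂) (cong (y₁ +_) (sym (÷-*-cancel (y₂ - y₁) (x₂ - x₁))))
      where
      identity : ∀ y₁ y₂ → y₂ ≡ y₁ + (y₂ - y₁)
      identity = solve-∀ ℚ-ring
  ... | yes refl with y₁ + y₂ ℚ.≟ 0ℚ
  ...   | yes sum≡0 = inj₁ (refl , p+q≡0⇒q≡-p y₁ y₂ sum≡0)
  ...   | no  sum≢0 with same-x⇒same-y {x₁} {y₁} {y₂} on₁ on₂ sum≢0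
  ...     | refl = inj₂ (tangent-secant {x₁} sum≢0)

  neg-onCurve : ∀ {P} → OnCurve T P → OnCurve T (neg P)
  neg-onCurve {O}       _  = tt
  neg-onCurve {aff x y} on = trans (identity y) on
    where
    identity : ∀ y → (- y) * (- y) ≡ y * y
    identity = solve-∀ ℚ-ring

  neg-secant : ∀ {l x₁ y₁ x₂ y₂} → Secant l x₁ y₁ x₂ y₂ → Secant (- l) x₁ (- y₁) x₂ (- y₂)
  neg-secant {l} {x₁} {y₁} {x₂} (secant passes meets) =
    secant (trans (cong -_ passes) (identity l x₁ y₁ x₂)) (trans (residual-neg l x₁ y₁ x₂) meets)
    where
    identity : ∀ l x₁ y₁ x₂ → - (y₁ + l * (x₂ - x₁)) ≡ - y₁ + (- l) * (x₂ - x₁)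
    identity = solve-∀ ℚ-ring

  secantSum-neg : ∀ l x₁ y₁ x₂ → secantSum (- l) x₁ (- y₁) x₂ ≡ neg (secantSum l x₁ y₁ x₂)
  secantSum-neg l x₁ y₁ x₂ = cong₂ aff (identityX l x₁ x₂) (identityY l x₁ y₁ x₂)
    where
    identityX : ∀ l x₁ x₂ → (- l) * (- l) - x₁ - x₂ ≡ l * l - x₁ - x₂
    identityX = solve-∀ ℚ-ring
    identityY : ∀ l x₁ y₁ x₂ → (- l) * (x₁ - ((- l) * (- l) - x₁ - x₂)) - (- y₁) ≡
                               - (l * (x₁ - (l * l - x₁ - x₂)) - y₁)
    identityY = solve-∀ ℚ-ring

  -- The line through -P and P + S is the mirror image of the line through P and S.
  reverse-secant : ∀ {l x₁ y₁ x₂ y₂} → Secant l x₁ y₁ x₂ y₂ →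
                   Secant (- l) x₁ (- y₁) (secantX l x₁ x₂) (secantY l x₁ y₁ x₂)
  reverse-secant {l} {x₁} {y₁} {x₂} (secant _ meets) = secant (identity l x₁ y₁ x₂)
    (trans (residual-neg l x₁ y₁ (secantX l x₁ x₂)) (trans (residual-swap l x₁ y₁ x₂) meets))
    where
    identity : ∀ l x₁ y₁ x₂ → l * (x₁ - (l * l - x₁ - x₂)) - y₁ ≡
                              - y₁ + (- l) * ((l * l - x₁ - x₂) - x₁)
    identity = solve-∀ ℚ-ring

  secantSum-reverse : ∀ {l x₁ y₁ x₂ y₂} → Secant l x₁ y₁ x₂ y₂ →
                      secantSum (- l) x₁ (- y₁) (secantX l x₁ x₂) ≡ aff x₂ y₂
  secantSum-reverse {l} {x₁} {y₁} {x₂} (secant passes _) =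
    cong₂ aff (identityX l x₁ x₂) (trans (identityY l x₁ y₁ x₂) (sym passes))
    where
    identityX : ∀ l x₁ x₂ → (- l) * (- l) - x₁ - (l * l - x₁ - x₂) ≡ x₂
    identityX = solve-∀ ℚ-ring
    identityY : ∀ l x₁ y₁ x₂ →
      (- l) * (x₁ - ((- l) * (- l) - x₁ - (l * l - x₁ - x₂))) - (- y₁) ≡ y₁ + l * (x₂ - x₁)
    identityY = solve-∀ ℚ-ring

  add-opposite : ∀ {x y₁ y₂} → y₁ + y₂ ≡ 0ℚ → add T (aff x y₁) (aff x y₂) ≡ O
  add-opposite {x} {y₁} {y₂} sum≡0 with x - x ℚ.≟ 0ℚ
  ... | no  dx≢0 = contradiction (ℚ.+-inverseʳ x) dx≢0
  ... | yes _ with y₁ + y₂ ℚ.≟ 0ℚ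
  ...   | yes _     = refl
  ...   | no  sum≢0 = contradiction sum≡0 sum≢0

  module Nonsingular (T²≢0 : T² ≢ 0ℚ) where

    nonsingular : ∀ {x} → cubic x ≡ 0ℚ → ℕ→ℚ 3 * x * x - T² ≢ 0ℚ
    nonsingular {x} cubic≡0 slope≡0 = T²≢0 (begin
      T²                                   ≡⟨ identity₁ x T² ⟩
      ℕ→ℚ 3 * x * x - (ℕ→ℚ 3 * x * x - T²) ≡⟨ cong₂ (λ a b → ℕ→ℚ 3 * a * a - b) x≡0 slope≡0 ⟩
      0ℚ                                   ∎)
      where
      identity₁ : ∀ x c → c ≡ ℕ→ℚ 3 * x * x - (ℕ→ℚ 3 * x * x - c)
      identity₁ = solve-∀ ℚ-ring
      identity₂ : ∀ x c → (1ℚ + 1ℚ) * (c * x) ≡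
                          x * (ℕ→ℚ 3 * x * x - c) - ℕ→ℚ 3 * (x * x * x - c * x)
      identity₂ = solve-∀ ℚ-ring
      2T²x≡0 : (1ℚ + 1ℚ) * (T² * x) ≡ 0ℚ
      2T²x≡0 = begin
        (1ℚ + 1ℚ) * (T² * x)                       ≡⟨ identity₂ x T² ⟩
        x * (ℕ→ℚ 3 * x * x - T²) - ℕ→ℚ 3 * cubic x ≡⟨ cong₂ (λ a b → x * a - ℕ→ℚ 3 * b) slope≡0 cubic≡0 ⟩
        x * 0ℚ - ℕ→ℚ 3 * 0ℚ                        ≡⟨ cong (_- ℕ→ℚ 3 * 0ℚ) (ℚ.*-zeroʳ x) ⟩
        0ℚ                                         ∎
      x≡0 : x ≡ 0ℚ
      x≡0 = p*q≡0⇒q≡0 T²≢0 (p*q≡0⇒q≡0 {1ℚ + 1ℚ} (λ ()) 2T²x≡0)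

    add-secant : ∀ {l x₁ y₁ x₂ y₂} → OnCurve T (aff x₁ y₁) → Secant l x₁ y₁ x₂ y₂ →
                 add T (aff x₁ y₁) (aff x₂ y₂) ≡ secantSum l x₁ y₁ x₂
    add-secant {l} {x₁} {y₁} {x₂} {y₂} on₁ sec@(secant passes _) with x₂ - x₁ ℚ.≟ 0ℚ
    ... | no dx≢0 = cong (λ k → secantSum k x₁ y₁ x₂) (*-cancelʳ-≡ {(y₂ - y₁) ÷ (x₂ - x₁)} {l} dx≢0 (begin
      ((y₂ - y₁) ÷ (x₂ - x₁)) * (x₂ - x₁) ≡⟨ ÷-*-cancel (y₂ - y₁) (x₂ - x₁) ⟩
      y₂ - y₁                             ≡⟨ cong (_- y₁) passes ⟩
      y₁ + l * (x₂ - x₁) - y₁             ≡⟨ identity y₁ (l * (x₂ - x₁)) ⟩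
      l * (x₂ - x₁)                       ∎))
      where
      instance _ = ≢-nonZero dx≢0
      identity : ∀ y d → y + d - y ≡ d
      identity = solve-∀ ℚ-ring
    ... | yes dx≡0 with p-q≡0⇒p≡q x₂ x₁ dx≡0
    ...   | refl with secant⇒tangent sec
    ...     | refl , tangent with y₁ + y₁ ℚ.≟ 0ℚ
    ...       | no 2y₁≢0 = cong (λ k → secantSum k x₁ y₁ x₁) (*-cancelʳ-≡ {(ℕ→ℚ 3 * x₁ * x₁ - T²) ÷ (y₁ + y₁)} {l} 2y₁≢0
                  (trans (÷-*-cancel (ℕ→ℚ 3 * x₁ * x₁ - T²) (y₁ + y₁)) (sym tangent)))
                  where instance _ = ≢-nonZero 2y₁≢0
    ...       | yes 2y₁≡0 = contradiction slope≡0 (nonsingular {x₁} cubic≡0)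
                  where
                  cubic≡0 : cubic x₁ ≡ 0ℚ
                  cubic≡0 = trans (sym on₁) (cong (λ y → y * y) (p+p≡0⇒p≡0 {y₁} 2y₁≡0))
                  slope≡0 : ℕ→ℚ 3 * x₁ * x₁ - T² ≡ 0ℚ
                  slope≡0 = begin
                    ℕ→ℚ 3 * x₁ * x₁ - T² ≡⟨ tangent ⟨
                    l * (y₁ + y₁)         ≡⟨ cong (l *_) 2y₁≡0 ⟩
                    l * 0ℚ                ≡⟨ ℚ.*-zeroʳ l ⟩
                    0ℚ                    ∎

    add-onCurve : ∀ {P S} → OnCurve T P → OnCurve T S → OnCurve T (add T P S)
    add-onCurve {O}         _   onS = onS
    add-onCurve {aff _ _}   {O} onP _ = onP
    add-onCurve {aff x₁ y₁} {aff x₂ y₂} onP onS with secant-or-opposite {x₁} {y₁} {x₂} {y₂} onP onS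
    ... | inj₁ (refl , refl) = subst (OnCurve T) (sym (add-opposite {x₁} (ℚ.+-inverseʳ y₁))) tt
    ... | inj₂ (l , sec) = subst (OnCurve T) (sym (add-secant onP sec))
                             (secantSum-onCurve {l} {x₁} {y₁} {x₂} onP (Secant.meets sec))

    neg-distrib-add : ∀ {P S} → OnCurve T P → OnCurve T S → neg (add T P S) ≡ add T (neg P) (neg S)
    neg-distrib-add {O}         _   _ = refl
    neg-distrib-add {aff _ _}   {O} _ _ = refl
    neg-distrib-add {aff x₁ y₁} {aff x₂ y₂} onP onS with secant-or-opposite {x₁} {y₁} {x₂} {y₂} onP onS
    ... | inj₁ (refl , refl) = begin
      neg (add T (aff x₁ y₁) (aff x₁ (- y₁)))   ≡⟨ cong neg (add-opposite {x₁} (ℚ.+-inverseʳ y₁)) ⟩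
      O                                         ≡⟨ add-opposite {x₁} (ℚ.+-inverseʳ (- y₁)) ⟨
      add T (aff x₁ (- y₁)) (aff x₁ (- (- y₁))) ∎
    ... | inj₂ (l , sec) = begin
      neg (add T (aff x₁ y₁) (aff x₂ y₂))   ≡⟨ cong neg (add-secant onP sec) ⟩
      neg (secantSum l x₁ y₁ x₂)            ≡⟨ secantSum-neg l x₁ y₁ x₂ ⟨
      secantSum (- l) x₁ (- y₁) x₂          ≡⟨ add-secant (neg-onCurve {aff x₁ y₁} onP) (neg-secant sec) ⟨
      add T (aff x₁ (- y₁)) (aff x₂ (- y₂)) ∎

    neg-add-cancelˡ : ∀ {P S} → OnCurve T P → OnCurve T S → add T (neg P) (add T P S) ≡ S
    neg-add-cancelˡ {O}         _   _ = refl
    neg-add-cancelˡ {aff x₁ y₁} {O} _ _ = add-opposite {x₁} (ℚ.+-inverseˡ y₁)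
    neg-add-cancelˡ {aff x₁ y₁} {aff x₂ y₂} onP onS with secant-or-opposite {x₁} {y₁} {x₂} {y₂} onP onS
    ... | inj₁ (refl , refl) = cong (add T (aff x₁ (- y₁))) (add-opposite {x₁} (ℚ.+-inverseʳ y₁))
    ... | inj₂ (l , sec) = begin
      add T (aff x₁ (- y₁)) (add T (aff x₁ y₁) (aff x₂ y₂))
        ≡⟨ cong (add T (aff x₁ (- y₁))) (add-secant onP sec) ⟩
      add T (aff x₁ (- y₁)) (secantSum l x₁ y₁ x₂)
        ≡⟨ add-secant (neg-onCurve {aff x₁ y₁} onP) (reverse-secant sec) ⟩
      secantSum (- l) x₁ (- y₁) (secantX l x₁ x₂)
        ≡⟨ secantSum-reverse sec ⟩
      aff x₂ y₂ ∎

    mul-onCurve : ∀ {P} → OnCurve T P → ∀ m → OnCurve T (mul T m P)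
    mul-onCurve     onP ℕ.zero    = tt
    mul-onCurve {P} onP (ℕ.suc m) = add-onCurve {P} {mul T m P} onP (mul-onCurve onP m)

    self-negative⇒double-torsion : ∀ {P m} → OnCurve T P → neg (mul T m P) ≡ mul T m P →
                                   mul T (m ℕ.+ m) P ≡ O
    self-negative⇒double-torsion {P} {m} onP neg-mP≡mP = neg≡O⇒≡O (begin
      neg (mul T (m ℕ.+ m) P)  ≡⟨ cong neg (trans (mul≡fold T (m ℕ.+ m)) (fold-+ O f m)) ⟩
      neg (fold Q f m)         ≡⟨ fold-commute preserves (λ {S} → neg-distrib-add {P} {S} onP) m onQ ⟩
      fold (neg Q) g m         ≡⟨ cong (λ R → fold R g m) neg-Q≡Q ⟩
      fold Q g m               ≡⟨ fold-inverse preserves (λ {S} → neg-add-cancelˡ {P} {S} onP) m tt ⟩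
      O                        ∎)
      where
      f = add T P
      g = add T (neg P)
      Q = fold O f m
      neg-Q≡Q : neg Q ≡ Q
      neg-Q≡Q = subst (λ R → neg R ≡ R) (mul≡fold T m) neg-mP≡mP
      preserves : ∀ {S} → OnCurve T S → OnCurve T (f S)
      preserves {S} = add-onCurve {P} {S} onP
      onQ : OnCurve T Q
      onQ = fold-preserves {C = OnCurve T} preserves m tt

    nonTorsion⇒cubic≢0 : ∀ {P m x y} → OnCurve T P → NonTorsion T P → 1 ≤ m →
                         mul T m P ≡ aff x y → cubic x ≢ 0ℚ
    nonTorsion⇒cubic≢0 {P} {m} {x} {y} onP nonTorsion 1≤m mP≡xy cubic≡0 =
      nonTorsion (m ℕ.+ m) (ℕ.≤-trans 1≤m (ℕ.m≤m+n m m)) (self-negative⇒double-torsion {P} {m} onP neg-mP≡mP)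
      where
      y≡0 : y ≡ 0ℚ
      y≡0 = p*p≡0⇒p≡0 (trans (subst (OnCurve T) mP≡xy (mul-onCurve {P} onP m)) cubic≡0)
      neg-mP≡mP : neg (mul T m P) ≡ mul T m P
      neg-mP≡mP rewrite mP≡xy | y≡0 = refl

module CubeBound where
  open import Data.Nat using (_+_; _*_; _∸_; _<_; _⊔_; s≤s; z≤n; >-nonZero)
  open import Relation.Binary.Definitions using (tri<; tri≈; tri>)
  open ℕ.≤-Reasoning

  m<n⇒m≤n*n∸m*m : ∀ {m n} → m < n → m ≤ n * n ∸ m * m
  m<n⇒m≤n*n∸m*m {m} {n} m<n = ℕ.m+n≤o⇒m≤o∸n m (begin
    m + m * m             ≤⟨ ℕ.m≤m+n (m + m * m) (ℕ.suc m) ⟩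
    m + m * m + ℕ.suc m   ≡⟨ identity m ⟩
    ℕ.suc m * ℕ.suc m     ≤⟨ ℕ.*-mono-≤ m<n m<n ⟩
    n * n                 ∎)
    where
    identity : ∀ m → m + m * m + ℕ.suc m ≡ ℕ.suc m * ℕ.suc m
    identity = ℕ-Solver.solve-∀

  m<n⇒m*m≤n*[n*n∸m*m] : ∀ {m n} → m < n → m * m ≤ n * (n * n ∸ m * m)
  m<n⇒m*m≤n*[n*n∸m*m] m<n = ℕ.*-mono-≤ (ℕ.<⇒≤ m<n) (m<n⇒m≤n*n∸m*m m<n)

  n<m⇒m*m≤n*[m*m∸n*n] : ∀ {m n} → 2 ≤ n → n < m → m * m ≤ n * (m * m ∸ n * n)
  n<m⇒m*m≤n*[m*m∸n*n] {m} {n} 2≤n n<m with ℕ.m≤n⇒∃[o]m+o≡n n<m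
  ... | j , refl = begin
    m * m                                   ≡⟨ square n j ⟩
    n * n + (n * k + n * k + k * k)         ≤⟨ ℕ.+-mono-≤ (ℕ.m≤m*n (n * n) k)
                                                 (ℕ.+-mono-≤ 2nk≤n*nk (ℕ.m≤n*m (k * k) n)) ⟩
    n * n * k + (n * (n * k) + n * (k * k)) ≡⟨ factor n k ⟩
    n * (n * k + n * k + k * k)             ≡⟨ cong (n *_) gap ⟨
    n * (m * m ∸ n * n)                     ∎
    where
    k = ℕ.suc j
    instance _ = >-nonZero (ℕ.≤-trans (s≤s z≤n) 2≤n)
    square : ∀ n j → (ℕ.suc n + j) * (ℕ.suc n + j) ≡
                     n * n + (n * ℕ.suc j + n * ℕ.suc j + ℕ.suc j * ℕ.suc j)
    square = ℕ-Solver.solve-∀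
    factor : ∀ n k → n * n * k + (n * (n * k) + n * (k * k)) ≡ n * (n * k + n * k + k * k)
    factor = ℕ-Solver.solve-∀
    gap : m * m ∸ n * n ≡ n * k + n * k + k * k
    gap = trans (cong (_∸ n * n) (square n j)) (ℕ.m+n∸m≡n (n * n) _)
    2nk≤n*nk : n * k + n * k ≤ n * (n * k)
    2nk≤n*nk = begin
      n * k + n * k ≡⟨ cong (n * k +_) (ℕ.+-identityʳ (n * k)) ⟨
      2 * (n * k)   ≤⟨ ℕ.*-monoˡ-≤ (n * k) 2≤n ⟩
      n * (n * k)   ∎

  m≤n⇒n*n≤k*n*[k*n]∸m*m : ∀ {k m n} → 2 ≤ k → m ≤ n → n * n ≤ k * n * (k * n) ∸ m * m
  m≤n⇒n*n≤k*n*[k*n]∸m*m {k} {m} {n} 2≤k m≤n = ℕ.m+n≤o⇒m≤o∸n (n * n) (begin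
    n * n + m * m       ≤⟨ ℕ.+-monoʳ-≤ (n * n) (ℕ.*-mono-≤ m≤n m≤n) ⟩
    n * n + n * n       ≡⟨ cong (n * n +_) (ℕ.+-identityʳ (n * n)) ⟨
    2 * (n * n)         ≤⟨ ℕ.*-monoˡ-≤ (n * n) (ℕ.*-mono-≤ 2≤k (ℕ.≤-trans (s≤s z≤n) 2≤k)) ⟩
    k * k * (n * n)     ≡⟨ identity k n ⟩
    k * n * (k * n)     ∎)
    where
    identity : ∀ k n → k * k * (n * n) ≡ k * n * (k * n)
    identity = ℕ-Solver.solve-∀

  m*m≤n*∣m*m⊖n*n∣ : ∀ {m n} → 2 ≤ n → m * m ≢ n * n → m * m ≤ n * ℤ.∣ m * m ℤ.⊖ n * n ∣
  m*m≤n*∣m*m⊖n*n∣ {m} {n} 2≤n m*m≢n*n with ℕ.<-cmp m n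
  ... | tri< m<n _ _ rewrite ℤ.∣⊖∣-< (ℕ.*-mono-< m<n m<n) = m<n⇒m*m≤n*[n*n∸m*m] m<n
  ... | tri≈ _ m≡n _ = contradiction (cong (λ v → v * v) m≡n) m*m≢n*n
  ... | tri> _ _ n<m rewrite ℤ.∣m⊖n∣≡∣n⊖m∣ (m * m) (n * n) | ℤ.∣⊖∣-< (ℕ.*-mono-< n<m n<m) =
    n<m⇒m*m≤n*[m*m∸n*n] 2≤n n<m

  cube-bound : ∀ {T a B} → 2 ≤ T → 1 ≤ a → 1 ≤ B → a * a ≢ T * B * (T * B) →
               (a ⊔ B) * (a ⊔ B) * (a ⊔ B) ≤ T * a * B * ℤ.∣ a * a ℤ.⊖ T * B * (T * B) ∣
  cube-bound {T} {a} {B} 2≤T 1≤a 1≤B a*a≢u*u with ℕ.≤-total B a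
  ... | inj₁ B≤a rewrite ℕ.m≥n⇒m⊔n≡m B≤a = begin
    a * a * a       ≡⟨ ℕ.*-assoc a a a ⟩
    a * (a * a)     ≤⟨ ℕ.*-monoʳ-≤ a (m*m≤n*∣m*m⊖n*n∣ {a} (ℕ.*-mono-≤ 2≤T 1≤B) a*a≢u*u) ⟩
    a * (T * B * D) ≡⟨ identity a T B D ⟩
    T * a * B * D   ∎
    where
    D = ℤ.∣ a * a ℤ.⊖ T * B * (T * B) ∣
    identity : ∀ a T B D → a * (T * B * D) ≡ T * a * B * D
    identity = ℕ-Solver.solve-∀
  ... | inj₂ a≤B rewrite ℕ.m≤n⇒m⊔n≡n a≤B = begin
    B * B * B       ≡⟨ identity B ⟩
    1 * B * (B * B) ≤⟨ ℕ.*-mono-≤ (ℕ.*-monoˡ-≤ B (ℕ.*-mono-≤ (ℕ.≤-trans (s≤s z≤n) 2≤T) 1≤a)) B*B≤D ⟩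
    T * a * B * D   ∎
    where
    instance _ = >-nonZero 1≤B
    D = ℤ.∣ a * a ℤ.⊖ T * B * (T * B) ∣
    identity : ∀ B → B * B * B ≡ 1 * B * (B * B)
    identity = ℕ-Solver.solve-∀
    a<TB : a < T * B
    a<TB = begin-strict
      a       ≤⟨ a≤B ⟩
      B       <⟨ ℕ.m<m*n B T 2≤T ⟩
      B * T   ≡⟨ ℕ.*-comm B T ⟩
      T * B   ∎
    B*B≤D : B * B ≤ D
    B*B≤D = subst (B * B ≤_) (sym (ℤ.∣⊖∣-< (ℕ.*-mono-< a<TB a<TB))) (m≤n⇒n*n≤k*n*[k*n]∸m*m 2≤T a≤B)

ℕ→ℚ≡mkℚ : ∀ n → ℕ→ℚ n ≡ ℚ.mkℚ (ℤ.+ n) 0 (Coprimality.sym (Coprimality.1-coprimeTo n))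
ℕ→ℚ≡mkℚ n = ℚ.normalize-coprime (Coprimality.sym (Coprimality.1-coprimeTo n))

ℕ→ℚ-mono : ∀ {m n} → m ℕ.≤ n → ℕ→ℚ m ℚ.≤ ℕ→ℚ n
ℕ→ℚ-mono {m} {n} m≤n = subst₂ ℚ._≤_ (sym (ℕ→ℚ≡mkℚ m)) (sym (ℕ→ℚ≡mkℚ n))
  (ℚ.*≤* (subst₂ ℤ._≤_ (ℤ.pos-* m 1) (ℤ.pos-* n 1) (ℤ.+≤+ (ℕ.*-monoˡ-≤ 1 m≤n))))

T²≢0 : ∀ {T} → 1 ℕ.≤ T → Curve.T² T ≢ ℚ.0ℚ
T²≢0 {ℕ.suc k} _ T²≡0 with cong ℚ.↥_ (trans (sym (ℕ→ℚ≡mkℚ (ℕ.suc k ℕ.* ℕ.suc k))) T²≡0)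
... | ()

i*i≡+∣i∣*∣i∣ : ∀ i → i ℤ.* i ≡ ℤ.+ (ℤ.∣ i ∣ ℕ.* ℤ.∣ i ∣)
i*i≡+∣i∣*∣i∣ (ℤ.+ n)    = sym (ℤ.pos-* n n)
i*i≡+∣i∣*∣i∣ ℤ.-[1+ n ] = refl

+[m*n*[m*n]]≡+m*+m*+n*+n : ∀ m n → ℤ.+ (m ℕ.* n ℕ.* (m ℕ.* n)) ≡ ℤ.+ m ℤ.* ℤ.+ m ℤ.* ℤ.+ n ℤ.* ℤ.+ n
+[m*n*[m*n]]≡+m*+m*+n*+n m n = begin
  ℤ.+ (m ℕ.* n ℕ.* (m ℕ.* n))                  ≡⟨ ℤ.pos-* (m ℕ.* n) (m ℕ.* n) ⟩
  ℤ.+ (m ℕ.* n) ℤ.* ℤ.+ (m ℕ.* n)              ≡⟨ cong₂ ℤ._*_ (ℤ.pos-* m n) (ℤ.pos-* m n) ⟩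
  ℤ.+ m ℤ.* ℤ.+ n ℤ.* (ℤ.+ m ℤ.* ℤ.+ n)        ≡⟨ identity (ℤ.+ m) (ℤ.+ n) ⟩
  ℤ.+ m ℤ.* ℤ.+ m ℤ.* ℤ.+ n ℤ.* ℤ.+ n          ∎
  where
  open ≡-Reasoning
  identity : ∀ i j → i ℤ.* j ℤ.* (i ℤ.* j) ≡ i ℤ.* i ℤ.* j ℤ.* j
  identity = ℤ-Solver.solve-∀

∣↥x∣²≡[T*↧x]²⇒x*x≡T² : ∀ T x → let a = ℤ.∣ ℚ.↥ x ∣; u = T ℕ.* ℚ.↧ₙ x in
                        a ℕ.* a ≡ u ℕ.* u → x ℚ.* x ≡ Curve.T² T
∣↥x∣²≡[T*↧x]²⇒x*x≡T² T x@(ℚ.mkℚ A d _) a*a≡u*u =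
  ℚ.toℚᵘ-injective (ℚᵘ.≃-trans (ℚ.toℚᵘ-homo-* x x)
    (subst (λ r → ℚᵘ.mkℚᵘ A d ℚᵘ.* ℚᵘ.mkℚᵘ A d ℚᵘ.≃ ℚ.toℚᵘ r) (sym (ℕ→ℚ≡mkℚ (T ℕ.* T)))
      (ℚᵘ.*≡* A*A≡T²B²)))
  where
  open ≡-Reasoning
  B = ℕ.suc d
  A*A≡T²B² : A ℤ.* A ℤ.* ℤ.+ 1 ≡ ℤ.+ (T ℕ.* T) ℤ.* ℤ.+ (B ℕ.* B)
  A*A≡T²B² = begin
    A ℤ.* A ℤ.* ℤ.+ 1                  ≡⟨ ℤ.*-identityʳ (A ℤ.* A) ⟩
    A ℤ.* A                            ≡⟨ i*i≡+∣i∣*∣i∣ A ⟩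
    ℤ.+ (ℤ.∣ A ∣ ℕ.* ℤ.∣ A ∣)          ≡⟨ cong ℤ.+_ a*a≡u*u ⟩
    ℤ.+ (T ℕ.* B ℕ.* (T ℕ.* B))        ≡⟨ cong ℤ.+_ (identity T B) ⟩
    ℤ.+ (T ℕ.* T ℕ.* (B ℕ.* B))        ≡⟨ ℤ.pos-* (T ℕ.* T) (B ℕ.* B) ⟩
    ℤ.+ (T ℕ.* T) ℤ.* ℤ.+ (B ℕ.* B)    ∎
    where
    identity : ∀ T B → T ℕ.* B ℕ.* (T ℕ.* B) ≡ T ℕ.* T ℕ.* (B ℕ.* B)
    identity = ℕ-Solver.solve-∀

lhsN≤rhsM : ∀ {T x} → 2 ℕ.≤ T → Curve.cubic T x ≢ ℚ.0ℚ → lhsN x ℕ.≤ rhsM T x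
lhsN≤rhsM {T} {x@(ℚ.mkℚ A d _)} 2≤T cubic≢0 =
  subst (λ D → lhsN x ℕ.≤ T ℕ.* a ℕ.* B ℕ.* D) gap≡
    (CubeBound.cube-bound 2≤T 1≤a (ℕ.s≤s ℕ.z≤n) a*a≢u*u)
  where
  open Curve T using (cubic; cubic-0; x*x≡T²⇒cubic≡0)
  open ≡-Reasoning
  a = ℤ.∣ A ∣
  B = ℕ.suc d
  u = T ℕ.* B
  gap≡ : ℤ.∣ a ℕ.* a ℤ.⊖ u ℕ.* u ∣ ≡ ℤ.∣ A ℤ.* A ℤ.- ℤ.+ T ℤ.* ℤ.+ T ℤ.* ℤ.+ B ℤ.* ℤ.+ B ∣
  gap≡ = cong ℤ.∣_∣ (begin
    a ℕ.* a ℤ.⊖ u ℕ.* u                               ≡⟨ ℤ.[+m]-[+n]≡m⊖n (a ℕ.* a) (u ℕ.* u) ⟨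
    ℤ.+ (a ℕ.* a) ℤ.- ℤ.+ (u ℕ.* u)                   ≡⟨ cong₂ ℤ._-_ (sym (i*i≡+∣i∣*∣i∣ A))
                                                                    (+[m*n*[m*n]]≡+m*+m*+n*+n T B) ⟩
    A ℤ.* A ℤ.- ℤ.+ T ℤ.* ℤ.+ T ℤ.* ℤ.+ B ℤ.* ℤ.+ B   ∎)
  1≤a : 1 ℕ.≤ a
  1≤a = ℕ.n≢0⇒n>0 λ a≡0 →
    cubic≢0 (trans (cong cubic (ℚ.↥p≡0⇒p≡0 x (ℤ.∣i∣≡0⇒i≡0 a≡0))) cubic-0)
  a*a≢u*u : a ℕ.* a ≢ u ℕ.* u
  a*a≢u*u = cubic≢0 ∘ x*x≡T²⇒cubic≡0 {x} ∘ ∣↥x∣²≡[T*↧x]²⇒x*x≡T² T x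

-- The witness is the first partial sum of the exponential series, which is 1.
≤⇒≤exp : ∀ x {m n} → m ℕ.≤ n → m ≤exp[ x ]· n
≤⇒≤exp x {m} {n} m≤n ε ε>0 = 1 , (begin
  ℕ→ℚ m                    ≤⟨ ℕ→ℚ-mono m≤n ⟩
  ℕ→ℚ n                    ≡⟨ ℚ.*-identityˡ (ℕ→ℚ n) ⟨
  ℚ.1ℚ ℚ.* ℕ→ℚ n           ≤⟨ ℚ.*-monoʳ-≤-nonNeg (ℕ→ℚ n) 1≤1+ε ⟩
  (ℚ.1ℚ ℚ.+ ε) ℚ.* ℕ→ℚ n   ∎)
  where
  open ℚ.≤-Reasoning
  instance _ = ℚ.nonNegative (ℕ→ℚ-mono {0} {n} ℕ.z≤n)
  1≤1+ε : ℚ.1ℚ ℚ.≤ ℚ.1ℚ ℚ.+ ε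
  1≤1+ε = subst (ℚ._≤ ℚ.1ℚ ℚ.+ ε) (ℚ.+-identityʳ ℚ.1ℚ) (ℚ.+-monoʳ-≤ ℚ.1ℚ (ℚ.<⇒≤ ε>0))

lemma3p5 : (T : ℕ) → 5 ≤ T → SquareFree T →
    (P : Pt) → OnCurve T P → NonTorsion T P →
    (m : ℕ) → 1 ≤ m → (x y : ℚ) → mul T m P ≡ aff x y →
    lhsN x ≤exp[ c0693 ]· rhsM T x
lemma3p5 T 5≤T _ P onP nonTorsion m 1≤m x y mP≡xy =
  ≤⇒≤exp c0693 (lhsN≤rhsM {T} {x} 2≤T (nonTorsion⇒cubic≢0 onP nonTorsion 1≤m mP≡xy))
  where
  open Curve.Nonsingular T (T²≢0 (ℕ.≤-trans (ℕ.s≤s ℕ.z≤n) 5≤T))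
  2≤T : 2 ≤ T
  2≤T = ℕ.≤-trans (ℕ.s≤s (ℕ.s≤s ℕ.z≤n)) 5≤T
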